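{- Let $G$ be a $(P_7,C_4,C_6)$-free graph, let $x_0,x_1,\dots,x_6,x_0$ (indices in $\mathbb{Z}_7$) be a 7-hole in $G$, and let $v\in V(G)\setminus\{x_0,\dots,x_6\}$. Then one of the following holds: (a) $v$ is anticomplete to $\{x_0,\dots,x_6\}$; (b) there exists $i\in\mathbb{Z}_7$ with $N_G(v)\cap\{x_0,\dots,x_6\}=\{x_{i-1},x_i,x_{i+1}\}$; (c) there exists $i\in\mathbb{Z}_7$ with $N_G(v)\cap\{x_0,\dots,x_6\}=\{x_i,x_{i+1},x_{i+4}\}$; (d) there exists $i\in\mathbb{Z}_7$ with $N_G(v)\cap\{x_0,\dots,x_6\}=\{x_i,x_{i+1},x_{i+2},x_{i+3},x_{i+4}\}$; (e) $v$ is complete to $\{x_0,\dots,x_6\}$.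
   Context: All graphs are finite, simple and nonnull. $G$ is $H$-free if no induced subgraph is isomorphic to $H$; $P_k$, $C_k$ are the path and cycle on $k$ vertices. A 7-hole $x_0,x_1,\dots,x_6,x_0$ means $x_0,\dots,x_6$ are distinct vertices and the edges of $G[\{x_0,\dots,x_6\}]$ are exactly $x_ix_{i+1}$ ($i\in\mathbb{Z}_7$). -}

module Defs where

open import Data.Nat using (ℕ; suc; _+_; _∸_; _≡ᵇ_)
open import Data.Nat.DivMod using (_mod_)
open import Data.Fin using (Fin; toℕ)
open import Data.Bool using (T)
open import Data.Product using (_×_; Σ; ∃-syntax)
open import Data.Sum using (_⊎_)
open import Relation.Nullary using (¬_; Dec)
open import Relation.Binary.PropositionalEquality using (_≡_)
open import Function.Definitions using (Injective)
open import Function.Bundles using (_⇔_)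
open import Level using (0ℓ)

record Graph : Set₁ where
  field
    n    : ℕ
    Adj  : Fin n → Fin n → Set
    dec  : ∀ u v → Dec (Adj u v)
    sym  : ∀ {u v} → Adj u v → Adj v u
    irr  : ∀ v → ¬ Adj v v

open Graph public

PathAdj : (k : ℕ) → Fin k → Fin k → Set
PathAdj k i j = (suc (toℕ i) ≡ toℕ j) ⊎ (suc (toℕ j) ≡ toℕ i)

CycleAdj : (k : ℕ) → Fin k → Fin k → Set
CycleAdj k i j = PathAdj k i j
  ⊎ ((toℕ i ≡ 0) × (toℕ j ≡ k ∸ 1))
  ⊎ ((toℕ j ≡ 0) × (toℕ i ≡ k ∸ 1))

InducedCopy : (G : Graph) (k : ℕ) (H : Fin k → Fin k → Set) → Set
InducedCopy G k H =
  Σ (Fin k → Fin (n G)) λ f →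
    Injective _≡_ _≡_ f × (∀ i j → Adj G (f i) (f j) ⇔ H i j)

Free : (G : Graph) (k : ℕ) (H : Fin k → Fin k → Set) → Set
Free G k H = ¬ InducedCopy G k H

P7C4C6-free : Graph → Set
P7C4C6-free G = Free G 7 (PathAdj 7) × Free G 4 (CycleAdj 4) × Free G 6 (CycleAdj 6)

_⊕_ : Fin 7 → ℕ → Fin 7
i ⊕ a = (toℕ i + a) mod 7

_⊖1 : Fin 7 → Fin 7
i ⊖1 = i ⊕ 6

Hole7 : (G : Graph) → (Fin 7 → Fin (n G)) → Set
Hole7 G x = Injective _≡_ _≡_ x × (∀ i j → Adj G (x i) (x j) ⇔ ((j ≡ i ⊕ 1) ⊎ (i ≡ j ⊕ 1)))

-- N_G(v) ∩ {x_0..x_6} = {x_j : P j}   (x injective, so stated on indices).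
NbrsOnHole : (G : Graph) → (Fin 7 → Fin (n G)) → Fin (n G) → (Fin 7 → Set) → Set
NbrsOnHole G x v P = ∀ j → Adj G v (x j) ⇔ P j

{-# OPTIONS --safe #-}
-- If v sees x_i and x_{i+L+1} but none of the L hole vertices strictly
-- between them, then v, x_i, …, x_{i+L+1} is an induced cycle of length L + 3;
-- if v sees x_i but none of x_{i+1}, …, x_{i+5}, then v, x_i, …, x_{i+5} is an
-- induced P_7.  So when v has a neighbour on the hole, every maximal run of
-- non-neighbours has length 2 or 4, and the only such neighbour sets are the
-- listed ones.  The subgraph induced by the hole and v is the cone over C_7
-- with apex v determined by the neighbour pattern of v; both the induced
-- subgraphs above and the classification of the 2⁷ patterns are checked on
-- that cone.
module Submission where

open import Defs
open import Data.Bool using (Bool; true; false; T; T?)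
open import Data.Empty using (⊥; ⊥-elim)
open import Data.Fin using (Fin; zero; suc; toℕ; _≟_; #_)
open import Data.Fin.Properties using (all?; any?)
open import Data.Nat using (ℕ; suc; _+_; _∸_) renaming (_≟_ to _≟ℕ_)
open import Data.Product using (_×_; _,_; ∃-syntax; map₂)
open import Data.Sum using (_⊎_; inj₁; inj₂; swap; [_,_]′) renaming (map to ⊎-map)
open import Data.Unit using (⊤; tt)
open import Data.Vec using (Vec; []; _∷_; lookup; tabulate)
open import Data.Vec.Properties using (lookup∘tabulate)
import Data.Vec.Functional as Vector
open import Function using (_∘_)
open import Function.Bundles using (_⇔_; mk⇔; Equivalence)
open import Function.Definitions using (Injective)
open import Function.Properties.Equivalence using () renaming (trans to ⇔-trans)
open import Relation.Nullary using (¬_; Dec; yes; no)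
open import Relation.Nullary.Decidable
  using (map′; _×-dec_; _⊎-dec_; _→-dec_; ¬?; from-yes; isYes; toWitness; fromWitness)
open import Relation.Binary.PropositionalEquality using (_≡_; refl; cong)
import Relation.Binary.PropositionalEquality as ≡

open Equivalence using (to; from)

_⇔-dec_ : {A B : Set} → Dec A → Dec B → Dec (A ⇔ B)
a? ⇔-dec b? =
  map′ (λ (f , g) → mk⇔ f g) (λ e → to e , from e) ((a? →-dec b?) ×-dec (b? →-dec a?))

all-Vec-Bool? : ∀ {k} {P : Vec Bool k → Set} → (∀ bs → Dec (P bs)) → Dec (∀ bs → P bs)
all-Vec-Bool? {0} P? = map′ (λ { p [] → p }) (λ ∀p → ∀p []) (P? [])
all-Vec-Bool? {suc k} P? =
  map′ (λ { (f , t) (false ∷ bs) → f bs ; (f , t) (true ∷ bs) → t bs })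
       (λ ∀p → (λ bs → ∀p (false ∷ bs)) , (λ bs → ∀p (true ∷ bs)))
       (all-Vec-Bool? (P? ∘ (false ∷_)) ×-dec all-Vec-Bool? (P? ∘ (true ∷_)))

IsInducedCopy : (G : Graph) (k : ℕ) (H : Fin k → Fin k → Set) → (Fin k → Fin (n G)) → Set
IsInducedCopy G k H f = Injective _≡_ _≡_ f × (∀ i j → Adj G (f i) (f j) ⇔ H i j)

isInducedCopy? : ∀ G {k} {H : Fin k → Fin k → Set} →
  (∀ i j → Dec (H i j)) → ∀ f → Dec (IsInducedCopy G k H f)
isInducedCopy? G H? f = injective? ×-dec (all? λ i → all? λ j → dec G (f i) (f j) ⇔-dec H? i j)
  where
  injective? : Dec (Injective _≡_ _≡_ f)
  injective? = map′ (λ inj {i} {j} → inj i j) (λ inj i j → inj)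
                    (all? λ i → all? λ j → (f i ≟ f j) →-dec (i ≟ j))

InducedCopy-∘ : ∀ G F {k H} → InducedCopy G (n F) (Adj F) → InducedCopy F k H → InducedCopy G k H
InducedCopy-∘ G F (e , e-inj , e-adj) (f , f-inj , f-adj) =
  e ∘ f , f-inj ∘ e-inj , λ i j → ⇔-trans (e-adj (f i) (f j)) (f-adj i j)

pathAdj? : ∀ k i j → Dec (PathAdj k i j)
pathAdj? k i j = (suc (toℕ i) ≟ℕ toℕ j) ⊎-dec (suc (toℕ j) ≟ℕ toℕ i)

cycleAdj? : ∀ k i j → Dec (CycleAdj k i j)
cycleAdj? k i j =
  pathAdj? k i j
  ⊎-dec ((toℕ i ≟ℕ 0) ×-dec (toℕ j ≟ℕ k ∸ 1))
  ⊎-dec ((toℕ j ≟ℕ 0) ×-dec (toℕ i ≟ℕ k ∸ 1))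

HoleAdj : Fin 7 → Fin 7 → Set
HoleAdj i j = (j ≡ i ⊕ 1) ⊎ (i ≡ j ⊕ 1)

holeAdj? : ∀ i j → Dec (HoleAdj i j)
holeAdj? i j = (j ≟ i ⊕ 1) ⊎-dec (i ≟ j ⊕ 1)

HoleAdj-irrefl : ∀ i → ¬ HoleAdj i i
HoleAdj-irrefl = from-yes (all? λ i → ¬? (holeAdj? i i))

Sees : Vec Bool 7 → Fin 7 → Set
Sees b j = T (lookup b j)

-- Vertex zero is the apex, vertex suc j is x_j.
ConeAdj : Vec Bool 7 → Fin 8 → Fin 8 → Set
ConeAdj b zero    zero    = ⊥
ConeAdj b zero    (suc j) = Sees b j
ConeAdj b (suc i) zero    = Sees b i
ConeAdj b (suc i) (suc j) = HoleAdj i j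

cone : Vec Bool 7 → Graph
cone b = record
  { n = 8 ; Adj = ConeAdj b ; dec = coneAdj? ; sym = λ {u} {w} → coneAdj-sym u w ; irr = coneAdj-irr }
  where
  coneAdj? : ∀ u w → Dec (ConeAdj b u w)
  coneAdj? zero    zero    = no λ ()
  coneAdj? zero    (suc j) = T? (lookup b j)
  coneAdj? (suc i) zero    = T? (lookup b i)
  coneAdj? (suc i) (suc j) = holeAdj? i j

  coneAdj-sym : ∀ u w → ConeAdj b u w → ConeAdj b w u
  coneAdj-sym zero    (suc j) s = s
  coneAdj-sym (suc i) zero    s = s
  coneAdj-sym (suc i) (suc j) a = swap a

  coneAdj-irr : ∀ u → ¬ ConeAdj b u u
  coneAdj-irr zero    ()
  coneAdj-irr (suc i) = HoleAdj-irrefl i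

neighbourPattern : (G : Graph) → (Fin 7 → Fin (n G)) → Fin (n G) → Vec Bool 7
neighbourPattern G x v = tabulate (λ j → isYes (dec G v (x j)))

adj⇔sees-neighbourPattern : ∀ G x v j → Adj G v (x j) ⇔ Sees (neighbourPattern G x v) j
adj⇔sees-neighbourPattern G x v j
  rewrite lookup∘tabulate (λ j → isYes (dec G v (x j))) j = mk⇔ fromWitness toWitness

cone-embedding : ∀ G x → Hole7 G x → ∀ v → (∀ i → ¬ v ≡ x i) →
  InducedCopy G 8 (ConeAdj (neighbourPattern G x v))
cone-embedding G x (x-inj , x-adj) v v∉x = v Vector.∷ x , embedding-inj , embedding-adj
  where
  embedding-inj : Injective _≡_ _≡_ (v Vector.∷ x)
  embedding-inj {zero}  {zero}  _ = refl
  embedding-inj {zero}  {suc j} e = ⊥-elim (v∉x j e)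
  embedding-inj {suc i} {zero}  e = ⊥-elim (v∉x i (≡.sym e))
  embedding-inj {suc i} {suc j} e = cong suc (x-inj e)

  embedding-adj : ∀ u w →
    Adj G ((v Vector.∷ x) u) ((v Vector.∷ x) w) ⇔ ConeAdj (neighbourPattern G x v) u w
  embedding-adj zero    zero    = mk⇔ (irr G v) λ ()
  embedding-adj zero    (suc j) = adj⇔sees-neighbourPattern G x v j
  embedding-adj (suc i) zero    = ⇔-trans (mk⇔ (sym G) (sym G)) (adj⇔sees-neighbourPattern G x v i)
  embedding-adj (suc i) (suc j) = x-adj i j

GapAfter : Vec Bool 7 → Fin 7 → ℕ → Set
GapAfter b i L = Sees b i × (∀ (k : Fin L) → ¬ Sees b (i ⊕ suc (toℕ k)))

ClosedGap : Vec Bool 7 → Fin 7 → ℕ → Set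
ClosedGap b i L = GapAfter b i L × Sees b (i ⊕ suc L)

gapAfter? : ∀ b i L → Dec (GapAfter b i L)
gapAfter? b i L = T? (lookup b i) ×-dec (all? λ k → ¬? (T? (lookup b (i ⊕ suc (toℕ k)))))

closedGap? : ∀ b i L → Dec (ClosedGap b i L)
closedGap? b i L = gapAfter? b i L ×-dec T? (lookup b (i ⊕ suc L))

apexArc : Fin 7 → (k : ℕ) → Fin (suc k) → Fin 8
apexArc i k = zero Vector.∷ λ j → suc (i ⊕ toℕ j)

closedGap⇒cycle : ∀ (L : Fin 5) b i → ClosedGap b i (toℕ L) →
  IsInducedCopy (cone b) (3 + toℕ L) (CycleAdj (3 + toℕ L)) (apexArc i (2 + toℕ L))
closedGap⇒cycle = from-yes (all? {n = 5} λ L → all-Vec-Bool? λ b → all? λ i →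
  closedGap? b i (toℕ L) →-dec isInducedCopy? (cone b) (cycleAdj? _) (apexArc i (2 + toℕ L)))

gapAfter⇒path : ∀ (L : Fin 6) b i → GapAfter b i (toℕ L) →
  IsInducedCopy (cone b) (2 + toℕ L) (PathAdj (2 + toℕ L)) (apexArc i (1 + toℕ L))
gapAfter⇒path = from-yes (all? {n = 6} λ L → all-Vec-Bool? λ b → all? λ i →
  gapAfter? b i (toℕ L) →-dec isInducedCopy? (cone b) (pathAdj? _) (apexArc i (1 + toℕ L)))

Matches : Vec Bool 7 → (Fin 7 → Set) → Set
Matches b P = ∀ j → Sees b j ⇔ P j

matches? : ∀ b {P : Fin 7 → Set} → (∀ j → Dec (P j)) → Dec (Matches b P)
matches? b P? = all? λ j → T? (lookup b j) ⇔-dec P? j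

Outcomes : ((Fin 7 → Set) → Set) → Set
Outcomes Nbrs =
  Nbrs (λ _ → ⊥)
  ⊎ (∃[ i ] Nbrs (λ j → (j ≡ i ⊖1) ⊎ (j ≡ i) ⊎ (j ≡ i ⊕ 1)))
  ⊎ (∃[ i ] Nbrs (λ j → (j ≡ i) ⊎ (j ≡ i ⊕ 1) ⊎ (j ≡ i ⊕ 4)))
  ⊎ (∃[ i ] Nbrs (λ j → (j ≡ i) ⊎ (j ≡ i ⊕ 1) ⊎ (j ≡ i ⊕ 2) ⊎ (j ≡ i ⊕ 3) ⊎ (j ≡ i ⊕ 4)))
  ⊎ Nbrs (λ _ → ⊤)

Outcomes-map : {A B : (Fin 7 → Set) → Set} → (∀ {P} → A P → B P) → Outcomes A → Outcomes B
Outcomes-map f = ⊎-map f (⊎-map (map₂ f) (⊎-map (map₂ f) (⊎-map (map₂ f) f)))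

outcomes? : ∀ b → Dec (Outcomes (Matches b))
outcomes? b =
  matches? b (λ _ → no λ ())
  ⊎-dec any? (λ i → matches? b λ j → (j ≟ i ⊖1) ⊎-dec (j ≟ i) ⊎-dec (j ≟ i ⊕ 1))
  ⊎-dec any? (λ i → matches? b λ j → (j ≟ i) ⊎-dec (j ≟ i ⊕ 1) ⊎-dec (j ≟ i ⊕ 4))
  ⊎-dec any? (λ i → matches? b λ j →
          (j ≟ i) ⊎-dec (j ≟ i ⊕ 1) ⊎-dec (j ≟ i ⊕ 2) ⊎-dec (j ≟ i ⊕ 3) ⊎-dec (j ≟ i ⊕ 4))
  ⊎-dec matches? b (λ _ → yes tt)

Obstructed : Vec Bool 7 → Set
Obstructed b = ∃[ i ] (ClosedGap b i 1 ⊎ ClosedGap b i 3 ⊎ GapAfter b i 5)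

pattern-classification : ∀ b → Outcomes (Matches b) ⊎ Obstructed b
pattern-classification = from-yes (all-Vec-Bool? λ b → outcomes? b ⊎-dec
  any? λ i → closedGap? b i 1 ⊎-dec closedGap? b i 3 ⊎-dec gapAfter? b i 5)

free-cone-unobstructed : ∀ G → P7C4C6-free G → ∀ b → InducedCopy G 8 (ConeAdj b) → ¬ Obstructed b
free-cone-unobstructed G (_ , no-C4 , _) b embedding (i , inj₁ gap₁) =
  no-C4 (InducedCopy-∘ G (cone b) embedding (_ , closedGap⇒cycle (# 1) b i gap₁))
free-cone-unobstructed G (_ , _ , no-C6) b embedding (i , inj₂ (inj₁ gap₃)) =
  no-C6 (InducedCopy-∘ G (cone b) embedding (_ , closedGap⇒cycle (# 3) b i gap₃))
free-cone-unobstructed G (no-P7 , _ , _) b embedding (i , inj₂ (inj₂ gap₅)) =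
  no-P7 (InducedCopy-∘ G (cone b) embedding (_ , gapAfter⇒path (# 5) b i gap₅))

lemma3p7 : (G : Graph) → P7C4C6-free G →
    (x : Fin 7 → Fin (n G)) → Hole7 G x →
    (v : Fin (n G)) → (∀ i → ¬ (v ≡ x i)) →
    NbrsOnHole G x v (λ _ → ⊥)
    ⊎ (∃[ i ] NbrsOnHole G x v (λ j → (j ≡ i ⊖1) ⊎ (j ≡ i) ⊎ (j ≡ i ⊕ 1)))
    ⊎ (∃[ i ] NbrsOnHole G x v (λ j → (j ≡ i) ⊎ (j ≡ i ⊕ 1) ⊎ (j ≡ i ⊕ 4)))
    ⊎ (∃[ i ] NbrsOnHole G x v (λ j → (j ≡ i) ⊎ (j ≡ i ⊕ 1) ⊎ (j ≡ i ⊕ 2) ⊎ (j ≡ i ⊕ 3) ⊎ (j ≡ i ⊕ 4)))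
    ⊎ NbrsOnHole G x v (λ _ → ⊤)
lemma3p7 G free x hole v v∉x =
  [ Outcomes-map {A = Matches b} {B = NbrsOnHole G x v} matches⇒nbrs
  , ⊥-elim ∘ free-cone-unobstructed G free b (cone-embedding G x hole v v∉x)
  ]′ (pattern-classification b)
  where
  b : Vec Bool 7
  b = neighbourPattern G x v

  matches⇒nbrs : ∀ {P} → Matches b P → NbrsOnHole G x v P
  matches⇒nbrs m j = ⇔-trans (adj⇔sees-neighbourPattern G x v j) (m j)
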